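{- Let $d\ge 1$, let $\sigma_1,\ldots,\sigma_d\in S_n$ and $\sigma'_1,\ldots,\sigma'_d\in S_m$. Then the $d$-tuple $(\sigma_1,\ldots,\sigma_d)$ contains the $d$-tuple $(\sigma'_1,\ldots,\sigma'_d)$ in parallel if and only if the set partition $[\sigma_1,\ldots,\sigma_d]$ contains the set partition $[\sigma'_1,\ldots,\sigma'_d]$.
   Context: A set partition of $[N]$ is a partition of $[N]=\{1,\ldots,N\}$ into nonempty unordered sets (blocks). A set partition $\pi$ of $[N]$ contains a set partition $\pi'$ of $[M]$ if there is a subset $S\subseteq[N]$ with $|S|=M$ such that the restriction of $\pi$ to $S$, transported to $[M]$ via the unique order-preserving bijection $S\to[M]$, equals $\pi'$; otherwise $\pi$ avoids $\pi'$. For permutations $\sigma_1,\ldots,\sigma_d$ of $[n]$, the correspondent set partition $[\sigma_1,\ldots,\sigma_d]$ is the partition $T_1/\cdots/T_n$ of $[(d+1)n]$ with $T_i=\{i,\,n+\sigma_1(i),\,2n+\sigma_2(i),\ldots,dn+\sigma_d(i)\}$. A $d$-tuple $(\sigma_1,\ldots,\sigma_d)$ of permutations in $S_n$ contains $(\sigma'_1,\ldots,\sigma'_d)$ (permutations in $S_m$) in parallel if there exist indices $c_1<\cdots<c_m$ in $[n]$ such that for every $i\in[d]$ the sequence $\sigma_i(c_1)\sigma_i(c_2)\cdots\sigma_i(c_m)$ is order-isomorphic to $\sigma'_i$; otherwise it avoids it in parallel. -}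

module Defs where

open import Data.Nat using (ℕ; _*_)
import Data.Nat as ℕ
open import Data.Fin using (Fin; zero; suc; _<_; remQuot)
open import Data.Fin.Permutation using (Permutation′; _⟨$⟩ˡ_; _⟨$⟩ʳ_)
open import Data.Product using (Σ; _×_; _,_; proj₁; proj₂)
open import Relation.Binary.PropositionalEquality using (_≡_)
open import Relation.Binary.Structures using (IsEquivalence)
open import Function.Bundles using (_⇔_)


-- Points of [N] are 0-indexed: Fin N = {0, …, N-1}, with the usual order.

-- A set partition of [N], represented (faithfully, since blocks are
-- unordered) by its "same block" equivalence relation.
record SetPartition (N : ℕ) : Set₁ where
  field
    sameBlock : Fin N → Fin N → Set
    isEquivalence : IsEquivalence sameBlock
open SetPartition public

StrictlyIncreasing : ∀ {M N} → (Fin M → Fin N) → Set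
StrictlyIncreasing f = ∀ a b → a < b → f a < f b

-- π contains π': there is a subset S of [N] of size M (the image of a
-- strictly increasing map f : [M] → [N], f being the order-preserving
-- bijection [M] → S) such that the restriction of π to S, transported
-- to [M], equals π' (two elements share a block iff their images do).
PartitionContains : ∀ {N M} → SetPartition N → SetPartition M → Set
PartitionContains {N} {M} π π′ =
  Σ (Fin M → Fin N) λ f → StrictlyIncreasing f ×
    (∀ a b → sameBlock π (f a) (f b) ⇔ sameBlock π′ a b)

PermTuple : ℕ → ℕ → Set
PermTuple d n = Fin d → Permutation′ n

-- The point j·n + k of [(d+1)n] (j ∈ {0..d}, k ∈ {0..n-1}) lies in the
-- block T_i with i = k if j = 0 and i = σ_j⁻¹(k) if j ≥ 1
-- (since T_i = {i, n+σ₁(i), …, dn+σ_d(i)}).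
blockIndex : ∀ {d n} → PermTuple d n → Fin (ℕ.suc d) → Fin n → Fin n
blockIndex σ zero    k = k
blockIndex σ (suc j) k = σ j ⟨$⟩ˡ k

label : ∀ {d n} → PermTuple d n → Fin (ℕ.suc d * n) → Fin n
label {d} {n} σ x = blockIndex σ (proj₁ (remQuot {ℕ.suc d} n x)) (proj₂ (remQuot {ℕ.suc d} n x))

correspondent : ∀ {d n} → PermTuple d n → SetPartition (ℕ.suc d * n)
correspondent σ = record
  { sameBlock = λ x y → label σ x ≡ label σ y
  ; isEquivalence = record
      { refl = Relation.Binary.PropositionalEquality.refl
      ; sym = Relation.Binary.PropositionalEquality.sym
      ; trans = Relation.Binary.PropositionalEquality.trans } }
  where import Relation.Binary.PropositionalEquality

OrderIsomorphic : ∀ {m k} → (Fin m → Fin k) → Permutation′ m → Set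
OrderIsomorphic {m} s τ = ∀ a b → (s a < s b) ⇔ ((τ ⟨$⟩ʳ a) < (τ ⟨$⟩ʳ b))

ContainsInParallel : ∀ {d n m} → PermTuple d n → PermTuple d m → Set
ContainsInParallel {d} {n} {m} σ σ′ =
  Σ (Fin m → Fin n) λ c → StrictlyIncreasing c ×
    (∀ (i : Fin d) → OrderIsomorphic {k = n} (λ a → σ i ⟨$⟩ʳ c a) (σ′ i))

module Submission where

-- Write a point of [(d+1)n] as a pair (row j, column k) with
-- j ∈ [d+1], k ∈ [n] (Data.Fin's combine/remQuot); the order of [(d+1)n] is
-- the lexicographic order on such pairs.  Put ρ₀ = id and ρ_j = σ_j, so that
-- the point (j, k) lies in block ρ_j⁻¹(k): every block meets every row in
-- exactly one point, namely (j, ρ_j(i)) for block i.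
--
-- A map c : [m] → [n] witnesses parallel containment iff, for every row j,
-- the "row map" ρ_j ∘ c ∘ ρ′_j⁻¹ is strictly increasing (row 0 says that c
-- increases, row j ≥ 1 that σ_j ∘ c is order-isomorphic to σ′_j).
--   (⇒) Such a c gives the embedding (j, k) ↦ (j, ρ_j c ρ′_j⁻¹ k), which is
--       increasing because it is so on every row, and maps block i to c(i).
--   (⇐) An embedding f of partitions preserves rows: for a fixed block a of
--       σ′ the rows of the images of its d+1 points increase strictly (two
--       points of one block are never in the same row), and a strictly
--       increasing self-map of [d+1] is the identity.  Hence f maps block a to
--       a block c(a), and on row j it is exactly the row map of c, which is
--       increasing because f is.

open import Data.Nat as ℕ using (ℕ; suc; _*_; z≤n)
import Data.Nat.Properties as ℕ
open import Data.Fin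
  using (Fin; zero; suc; _<_; _≤_; toℕ; inject₁; opposite; combine; quotient; remainder)
open import Data.Fin.Properties
  using ( <-cmp; <-asym; <⇒≢; ≤-antisym; ≤-refl; toℕ<n; toℕ-inject₁; ≤̄⇒inject₁<
        ; opposite-prop; opposite-involutive; combine-monoˡ-<; combine-remQuot
        ; remQuot-combine; toℕ-combine )
open import Data.Fin.Permutation using (Permutation′; id; _⟨$⟩ˡ_; _⟨$⟩ʳ_; inverseˡ; inverseʳ)
open import Data.Product using (Σ; _×_; _,_; proj₁; proj₂)
open import Data.Sum using (_⊎_; inj₁; inj₂)
open import Function.Bundles using (_⇔_; mk⇔; Equivalence)
open import Relation.Binary.Definitions using (tri<; tri≈; tri>)
open import Relation.Binary.PropositionalEquality
open import Relation.Nullary using (contradiction)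

open import Defs

private
  variable
    d m n M N K : ℕ

strictlyIncreasing-injective : (f : Fin M → Fin N) → StrictlyIncreasing f →
  ∀ {a b} → f a ≡ f b → a ≡ b
strictlyIncreasing-injective f inc {a} {b} fa≡fb with <-cmp a b
... | tri< a<b _ _ = contradiction fa≡fb (<⇒≢ (inc a b a<b))
... | tri≈ _ a≡b _ = a≡b
... | tri> _ _ b<a = contradiction (sym fa≡fb) (<⇒≢ (inc b a b<a))

strictlyIncreasing-reflects : (f : Fin M → Fin N) → StrictlyIncreasing f →
  ∀ a b → f a < f b → a < b
strictlyIncreasing-reflects f inc a b fa<fb with <-cmp a b
... | tri< a<b _ _ = a<b
... | tri≈ _ refl _ = contradiction refl (<⇒≢ fa<fb)
... | tri> _ _ b<a = contradiction (inc b a b<a) (<-asym fa<fb)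

strictlyIncreasing-≥ : (f : Fin M → Fin N) → StrictlyIncreasing f →
  ∀ a → toℕ a ℕ.≤ toℕ (f a)
strictlyIncreasing-≥ f inc zero    = z≤n
strictlyIncreasing-≥ f inc (suc a) = begin-strict
  toℕ a                  ≤⟨ strictlyIncreasing-≥ f↾ f↾-increasing a ⟩
  toℕ (f (inject₁ a))    <⟨ inc (inject₁ a) (suc a) (≤̄⇒inject₁< ≤-refl) ⟩
  toℕ (f (suc a))        ∎
  where
  open ℕ.≤-Reasoning
  f↾ : Fin _ → Fin _
  f↾ x = f (inject₁ x)
  f↾-increasing : StrictlyIncreasing f↾
  f↾-increasing x y x<y = inc (inject₁ x) (inject₁ y)
    (subst₂ ℕ._<_ (sym (toℕ-inject₁ x)) (sym (toℕ-inject₁ y)) x<y)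

opposite-reverses-< : {i j : Fin N} → i < j → opposite j < opposite i
opposite-reverses-< {i = i} {j = j} i<j = subst₂ ℕ._<_ (sym (opposite-prop j)) (sym (opposite-prop i))
  (ℕ.∸-monoʳ-< (ℕ.s≤s i<j) (toℕ<n j))

-- The only strictly increasing self-map of Fin N is the identity: f moves
-- no point down, and neither does its conjugate by `opposite`, so f moves
-- no point up either.
strictlyIncreasing-endo-id : (f : Fin N → Fin N) → StrictlyIncreasing f → ∀ a → f a ≡ a
strictlyIncreasing-endo-id f inc a = ≤-antisym fa≤a (strictlyIncreasing-≥ f inc a)
  where
  f̄ : Fin _ → Fin _
  f̄ x = opposite (f (opposite x))

  f̄-increasing : StrictlyIncreasing f̄
  f̄-increasing x y x<y = opposite-reverses-< (inc _ _ (opposite-reverses-< x<y))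

  opposite-a≤opposite-fa : toℕ (opposite a) ℕ.≤ toℕ (opposite (f a))
  opposite-a≤opposite-fa = subst (λ z → toℕ (opposite a) ℕ.≤ toℕ (opposite (f z)))
    (opposite-involutive a) (strictlyIncreasing-≥ f̄ f̄-increasing (opposite a))

  fa≤a : f a ≤ a
  fa≤a = ℕ.≮⇒≥ (λ a<fa → ℕ.<⇒≱ (opposite-reverses-< a<fa) opposite-a≤opposite-fa)

orderIsomorphic⇔increasing : (s : Fin m → Fin K) (τ : Permutation′ m) →
  OrderIsomorphic s τ ⇔ StrictlyIncreasing (λ u → s (τ ⟨$⟩ˡ u))
orderIsomorphic⇔increasing s τ = mk⇔ to from
  where
  to : OrderIsomorphic s τ → StrictlyIncreasing (λ u → s (τ ⟨$⟩ˡ u))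
  to iso u v u<v = Equivalence.from (iso (τ ⟨$⟩ˡ u) (τ ⟨$⟩ˡ v))
    (subst₂ _<_ (sym (inverseʳ τ)) (sym (inverseʳ τ)) u<v)

  from : StrictlyIncreasing (λ u → s (τ ⟨$⟩ˡ u)) → OrderIsomorphic s τ
  from inc a b = mk⇔
    (λ sa<sb → strictlyIncreasing-reflects _ inc _ _
      (subst₂ _<_ (sym (cong s (inverseˡ τ))) (sym (cong s (inverseˡ τ))) sa<sb))
    (λ τa<τb → subst₂ _<_ (cong s (inverseˡ τ)) (cong s (inverseˡ τ)) (inc _ _ τa<τb))

-- Fin (M * n) viewed as M rows of n columns: the point in row j, column k
-- is `combine j k`, and the order is lexicographic in (row, column).
module Grid (M n : ℕ) where

  row : Fin (M * n) → Fin M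
  row = quotient n

  col : Fin (M * n) → Fin n
  col = remainder {M} n

  combine-row-col : ∀ x → combine (row x) (col x) ≡ x
  combine-row-col = combine-remQuot {M} n

  row-combine : ∀ j k → row (combine j k) ≡ j
  row-combine j k = cong proj₁ (remQuot-combine {M} {n} j k)

  col-combine : ∀ j k → col (combine j k) ≡ k
  col-combine j k = cong proj₂ (remQuot-combine {M} {n} j k)

  point-ext : ∀ {x y} → row x ≡ row y → col x ≡ col y → x ≡ y
  point-ext {x} {y} r≡ c≡ = begin
    x                          ≡⟨ combine-row-col x ⟨
    combine (row x) (col x)    ≡⟨ cong₂ combine r≡ c≡ ⟩
    combine (row y) (col y)    ≡⟨ combine-row-col y ⟩
    y                          ∎
    where open ≡-Reasoning

  Lex : Fin M → Fin n → Fin M → Fin n → Set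
  Lex j k j′ k′ = j < j′ ⊎ (j ≡ j′ × k < k′)

  combine-lex : ∀ {j k j′ k′} → Lex j k j′ k′ → combine j k < combine j′ k′
  combine-lex {k = k} {k′ = k′} (inj₁ j<j′) = combine-monoˡ-< k k′ j<j′
  combine-lex {j} {k} {k′ = k′} (inj₂ (refl , k<k′)) =
    subst₂ ℕ._<_ (sym (toℕ-combine j k)) (sym (toℕ-combine j k′))
      (ℕ.+-monoʳ-< (n * toℕ j) k<k′)

  lex⇒< : ∀ {x y} → Lex (row x) (col x) (row y) (col y) → x < y
  lex⇒< {x} {y} l = subst₂ _<_ (combine-row-col x) (combine-row-col y) (combine-lex l)

  <⇒lex : ∀ {x y} → x < y → Lex (row x) (col x) (row y) (col y)
  <⇒lex {x} {y} x<y with <-cmp (row x) (row y) | <-cmp (col x) (col y)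
  ... | tri< r< _ _ | _            = inj₁ r<
  ... | tri≈ _ r≡ _ | tri< c< _ _ = inj₂ (r≡ , c<)
  ... | tri≈ _ r≡ _ | tri≈ _ c≡ _ = contradiction (point-ext r≡ c≡) (<⇒≢ x<y)
  ... | tri≈ _ r≡ _ | tri> _ _ c> = contradiction (lex⇒< (inj₂ (sym r≡ , c>))) (<-asym x<y)
  ... | tri> _ _ r> | _            = contradiction (lex⇒< (inj₁ r>)) (<-asym x<y)

  <∧sameRow⇒col-< : ∀ {x y} → x < y → row x ≡ row y → col x < col y
  <∧sameRow⇒col-< x<y r≡ with <⇒lex x<y
  ... | inj₁ r<        = contradiction r≡ (<⇒≢ r<)
  ... | inj₂ (_ , c<)  = c<

-- ρ₀ = id and ρ_j = σ_j: block i meets row j in column ρ_j(i).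
rowPerm : PermTuple d n → Fin (suc d) → Permutation′ n
rowPerm σ zero    = id
rowPerm σ (suc j) = σ j

blockIndex≡rowPerm : (σ : PermTuple d n) → ∀ j k → blockIndex σ j k ≡ rowPerm σ j ⟨$⟩ˡ k
blockIndex≡rowPerm σ zero    k = refl
blockIndex≡rowPerm σ (suc j) k = refl

module Rows {d n : ℕ} (σ : PermTuple d n) where

  open Grid (suc d) n public

  ρ : Fin (suc d) → Permutation′ n
  ρ = rowPerm σ

  label≡ : ∀ x → label σ x ≡ ρ (row x) ⟨$⟩ˡ col x
  label≡ x = blockIndex≡rowPerm σ (row x) (col x)

  label-combine : ∀ j k → label σ (combine j k) ≡ ρ j ⟨$⟩ˡ k
  label-combine j k =
    trans (label≡ (combine j k)) (cong₂ (λ j k → ρ j ⟨$⟩ˡ k) (row-combine j k) (col-combine j k))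

  col≡ : ∀ x → col x ≡ ρ (row x) ⟨$⟩ʳ label σ x
  col≡ x = trans (sym (inverseʳ (ρ (row x)))) (cong (ρ (row x) ⟨$⟩ʳ_) (sym (label≡ x)))

  point : Fin (suc d) → Fin n → Fin (suc d * n)
  point j i = combine j (ρ j ⟨$⟩ʳ i)

  label-point : ∀ j i → label σ (point j i) ≡ i
  label-point j i = trans (label-combine j _) (inverseˡ (ρ j))

  point-row-label : ∀ x → point (row x) (label σ x) ≡ x
  point-row-label x = trans (cong (combine (row x)) (sym (col≡ x))) (combine-row-col x)

  sameBlock∧sameRow⇒≡ : ∀ {x y} → label σ x ≡ label σ y → row x ≡ row y → x ≡ y
  sameBlock∧sameRow⇒≡ {x} {y} b≡ r≡ =
    point-ext r≡ (trans (col≡ x) (trans (cong₂ (λ j i → ρ j ⟨$⟩ʳ i) r≡ b≡) (sym (col≡ y))))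

  sameBlock∧<⇒row-< : ∀ {x y} → x < y → label σ x ≡ label σ y → row x < row y
  sameBlock∧<⇒row-< x<y b≡ with <⇒lex x<y
  ... | inj₁ r<        = r<
  ... | inj₂ (r≡ , _)  = contradiction (sameBlock∧sameRow⇒≡ b≡ r≡) (<⇒≢ x<y)

rowMap : PermTuple d n → PermTuple d m → (Fin m → Fin n) → Fin (suc d) → Fin m → Fin n
rowMap σ σ′ c j k = rowPerm σ j ⟨$⟩ʳ c (rowPerm σ′ j ⟨$⟩ˡ k)

RowwiseIncreasing : PermTuple d n → PermTuple d m → (Fin m → Fin n) → Set
RowwiseIncreasing σ σ′ c = ∀ j → StrictlyIncreasing (rowMap σ σ′ c j)

-- Row 0 of the condition says that c increases, row j+1 that σ_j ∘ c is
-- order-isomorphic to σ′_j.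
parallel⇔rowwise : (σ : PermTuple d n) (σ′ : PermTuple d m) →
  ContainsInParallel σ σ′ ⇔ Σ (Fin m → Fin n) (RowwiseIncreasing σ σ′)
parallel⇔rowwise σ σ′ = mk⇔
  (λ (c , inc , iso) → c , λ
    { zero    → inc
    ; (suc i) → Equivalence.to (orderIsomorphic⇔increasing _ (σ′ i)) (iso i) })
  (λ (c , inc) → c , inc zero ,
    λ i → Equivalence.from (orderIsomorphic⇔increasing _ (σ′ i)) (inc (suc i)))

rowwise⇒partitionContains : (σ : PermTuple d n) (σ′ : PermTuple d m) →
  Σ (Fin m → Fin n) (RowwiseIncreasing σ σ′) →
  PartitionContains (correspondent σ) (correspondent σ′)
rowwise⇒partitionContains {d} {n} {m} σ σ′ (c , inc) = f , f-increasing , sameBlock⇔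
  where
  module S  = Rows σ
  module S′ = Rows σ′

  f : Fin (suc d * m) → Fin (suc d * n)
  f x = combine (S′.row x) (rowMap σ σ′ c (S′.row x) (S′.col x))

  f-increasing : StrictlyIncreasing f
  f-increasing x y x<y with S′.<⇒lex x<y
  ... | inj₁ r<         = S.combine-lex (inj₁ r<)
  ... | inj₂ (r≡ , c<)  = S.combine-lex (inj₂ (r≡ ,
    subst (λ j → rowMap σ σ′ c (S′.row x) (S′.col x) < rowMap σ σ′ c j (S′.col y))
      r≡ (inc (S′.row x) _ _ c<)))

  label-f : ∀ x → label σ (f x) ≡ c (label σ′ x)
  label-f x = begin
    label σ (f x)                                    ≡⟨ S.label-combine j _ ⟩
    S.ρ j ⟨$⟩ˡ (S.ρ j ⟨$⟩ʳ c (S′.ρ j ⟨$⟩ˡ S′.col x))  ≡⟨ inverseˡ (S.ρ j) ⟩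
    c (S′.ρ j ⟨$⟩ˡ S′.col x)                          ≡⟨ cong c (S′.label≡ x) ⟨
    c (label σ′ x)                                   ∎
    where
    open ≡-Reasoning
    j : Fin (suc d)
    j = S′.row x

  c-injective : ∀ {a b} → c a ≡ c b → a ≡ b
  c-injective = strictlyIncreasing-injective c (inc zero)

  sameBlock⇔ : ∀ x y → (label σ (f x) ≡ label σ (f y)) ⇔ (label σ′ x ≡ label σ′ y)
  sameBlock⇔ x y = mk⇔
    (λ e → c-injective (trans (sym (label-f x)) (trans e (label-f y))))
    (λ e → trans (label-f x) (trans (cong c e) (sym (label-f y))))

partitionContains⇒rowwise : (σ : PermTuple d n) (σ′ : PermTuple d m) →
  PartitionContains (correspondent σ) (correspondent σ′) →
  Σ (Fin m → Fin n) (RowwiseIncreasing σ σ′)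
partitionContains⇒rowwise {d} {n} {m} σ σ′ (f , f-increasing , sameBlock⇔) =
  c , rowMap-increasing
  where
  module S  = Rows σ
  module S′ = Rows σ′
  open ≡-Reasoning

  preservesBlocks : ∀ {x y} → label σ′ x ≡ label σ′ y → label σ (f x) ≡ label σ (f y)
  preservesBlocks = Equivalence.from (sameBlock⇔ _ _)

  rowsAlongBlock : ∀ a → StrictlyIncreasing (λ j → S.row (f (S′.point j a)))
  rowsAlongBlock a j j′ j<j′ = S.sameBlock∧<⇒row-<
    (f-increasing _ _ (S′.combine-lex (inj₁ j<j′)))
    (preservesBlocks (trans (S′.label-point j a) (sym (S′.label-point j′ a))))

  preservesRows : ∀ x → S.row (f x) ≡ S′.row x
  preservesRows x = begin
    S.row (f x)                                     ≡⟨ cong (λ y → S.row (f y)) (S′.point-row-label x) ⟨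
    S.row (f (S′.point (S′.row x) (label σ′ x)))     ≡⟨ strictlyIncreasing-endo-id _
                                                          (rowsAlongBlock (label σ′ x)) (S′.row x) ⟩
    S′.row x                                        ∎

  row-f-combine : ∀ j k → S.row (f (combine j k)) ≡ j
  row-f-combine j k = trans (preservesRows (combine j k)) (S′.row-combine j k)

  c : Fin m → Fin n
  c a = label σ (f (S′.point zero a))

  label-f : ∀ x → label σ (f x) ≡ c (label σ′ x)
  label-f x = preservesBlocks (sym (S′.label-point zero (label σ′ x)))

  col-f-combine : ∀ j k → S.col (f (combine j k)) ≡ rowMap σ σ′ c j k
  col-f-combine j k = begin
    S.col (f x)                            ≡⟨ S.col≡ (f x) ⟩
    S.ρ (S.row (f x)) ⟨$⟩ʳ label σ (f x)   ≡⟨ cong₂ (λ j i → S.ρ j ⟨$⟩ʳ i) (row-f-combine j k)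
                                               (trans (label-f x) (cong c (S′.label-combine j k))) ⟩
    rowMap σ σ′ c j k                      ∎
    where x = combine j k

  rowMap-increasing : RowwiseIncreasing σ σ′ c
  rowMap-increasing j k k′ k<k′ = subst₂ _<_ (col-f-combine j k) (col-f-combine j k′)
    (S.<∧sameRow⇒col-< (f-increasing _ _ (S′.combine-lex {j} (inj₂ (refl , k<k′))))
      (trans (row-f-combine j k) (sym (row-f-combine j k′))))

-- Proposition 2.8.
proposition2p8 : (d n m : ℕ) → 1 ℕ.≤ d → (σ : PermTuple d n) → (σ′ : PermTuple d m) →
    ContainsInParallel σ σ′ ⇔ PartitionContains (correspondent σ) (correspondent σ′)
proposition2p8 d n m _ σ σ′ = mk⇔
  (λ parallel → rowwise⇒partitionContains σ σ′ (Equivalence.to (parallel⇔rowwise σ σ′) parallel))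
  (λ contains → Equivalence.from (parallel⇔rowwise σ σ′) (partitionContains⇒rowwise σ σ′ contains))
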